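{- Let $A=(\Sigma,G,\mathcal I)$ and $A'=(\Sigma',G',\mathcal I')$ be proto-algorithms with $\mathcal I=(D,D_{in},D_{out},I)$ and $\mathcal I'=(D',D'_{in},D'_{out},I')$. If $A\sqsubseteq_a A'$, then there exist total functions $h_{in}:D_{in}\to D'_{in}$ and $h_{out}:D'_{out}\to D_{out}$ such that: (1) for all $d\in D_{in}$, if $\widehat A(d)$ is defined then $\widehat{A'}(h_{in}(d))$ is defined; (2) for all $d\in D_{in}$ and $d'\in D_{out}$, if $\widehat A(d)=d'$ then $h_{out}(\widehat{A'}(h_{in}(d)))=d'$; (3) for all $d\in D_{in}$ such that $\widehat A(d)$ is defined, $\mathrm{nas}(A,d)=\mathrm{nas}(A',h_{in}(d))$.
   Context: An alphabet is a pair $\Sigma=(F,P)$ of disjoint countable sets with distinguished $\mathsf{ini},\mathsf{fin}\in F$; $\widetilde F=F\setminus\{\mathsf{ini},\mathsf{fin}\}$. A rooted labeled directed graph is $(V,E,L_v,L_e,l,r)$ with $V$ nonempty finite, $E\subseteq V\times V$, $L_v,L_e$ countable, $l$ a partial function from $V\cup E$ to $L_v\cup L_e$ mapping vertices into $L_v$ and edges into $L_e$, $r\in V$; indegree/outdegree are numbers of in/out-neighbours; a cycle is $v_1\ldots v_{n+1}$ with $(v_i,v_{i+1})\in E$, $v_1,\dots,v_n$ distinct, $v_1=v_{n+1}$. A $\Sigma$-algorithm graph is such a graph with $L_v=F\cup P$, $L_e=\{0,1\}$, such that for every vertex $v$: $l(v)=\mathsf{ini}$ iff $v=r$; if $l(v)=\mathsf{ini}$: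 indegree $0$, outdegree $1$, outgoing edge unlabeled; if $l(v)=\mathsf{fin}$: indegree $>0$, outdegree $0$; if $l(v)\in\widetilde F$: indegree $>0$, outdegree $1$, outgoing edge unlabeled; if $l(v)\in P$: indegree $>0$, outdegree $2$, both outgoing edges labeled with different labels; and every cycle contains a vertex labeled by an element of $F$. A $\Sigma$-interpretation is $(D,D_{in},D_{out},I)$ with total computable $I(\mathsf{ini}):D_{in}\to D$, $I(\mathsf{fin}):D\to D_{out}$, $I(f):D\to D$ ($f\in\widetilde F$), $I(p):D\to\{0,1\}$ ($p\in P$), such that no proper subset of $D$ contains $I(\mathsf{ini})(D_{in})$ and is closed under all $I(f)$, $f\in\widetilde F$. A proto-algorithm is $A=(\Sigma,G,\mathcal I)$ with $G$ a $\Sigma$-algorithm graph $(V,E,L_v,L_e,l,r)$ and $\mathcal I$ a $\Sigma$-interpretation. The algorithmic step function $\mathrm{astep}_A$ on $D_{in}\cup(V\times D)\cup D_{out}$: $\mathrm{astep}_A(d)=(v',I(\mathsf{ini})(d))$ for $d\in D_{in}$, $(r,v')\in E$; $\mathrm{astep}_A((v,d))=(v',I(o)(d))$ if $l(v)=o\in\widetilde F$, $(v,v')\in E$; $\mathrm{astep}_A((v,d))=(v',d)$ if $l(v)=p\in P$, $(v,v')\in E$, $I(p)(d)=l((v,v'))$; $\mathrm{astep}_A((v,d))=I(\mathsf{fin})(d)$ if $l(v)=\mathsf{fin}$; $\mathrm{astep}_A(d)=d$ for $d\in D_{out}$. $\mathrm{astep}^n_A$ denotes its $n$-fold iterate ($\mathrm{astep}^0_A=\mathrm{id}$).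 An algorithmic simulation of $A$ by $A'$ is $R\subseteq (D_{in}\times D'_{in})\cup((V\times D)\times(V'\times D'))\cup(D_{out}\times D'_{out})$ such that every $d\in D_{in}$ is related to a unique $d'\in D'_{in}$, every $d'\in D'_{out}$ is related to a unique $d\in D_{out}$ (i.e. there is a unique $d$ with $(d,d')\in R$), and $(d,d')\in R$ implies $(\mathrm{astep}_A(d),\mathrm{astep}_{A'}(d'))\in R$. $A\sqsubseteq_a A'$ means such an $R$ exists. The function computed by $A$ is the partial function $\widehat A:D_{in}\to D_{out}$, $\widehat A(d)=\mathrm{astep}^*_A(d)$, where $\mathrm{astep}^*_A$ is the least-defined partial function on $D_{in}\cup(V\times D)\cup D_{out}$ with $\mathrm{astep}^*_A(d)=\mathrm{astep}^*_A(\mathrm{astep}_A(d))$ if $\mathrm{astep}_A(d)\in V\times D$ and $\mathrm{astep}^*_A(d)=\mathrm{astep}_A(d)$ if $\mathrm{astep}_A(d)\in D_{out}$. For $d\in D_{in}$ with $\widehat A(d)$ defined, $\mathrm{nas}(A,d)$ is the least $n\in\mathbb N$ with $\mathrm{astep}^n_A(d)=\widehat A(d)$. -}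

module Defs where

open import Data.Nat using (ℕ; zero; suc; _≤_; _>_)
open import Data.Bool using (Bool; true; false)
open import Data.Fin using (Fin)
open import Data.List using (List; []; _∷_; _++_; [_]; length; filterᵇ; allFin)
open import Data.List.Relation.Unary.Any using (Any)
open import Data.List.Relation.Unary.Linked using (Linked)
open import Data.List.Relation.Unary.Unique.Propositional using (Unique)
open import Data.Maybe using (Maybe; just; nothing)
open import Data.Product using (Σ; _×_; _,_; ∃)
open import Data.Sum using (_⊎_; inj₁; inj₂)
open import Data.Empty using (⊥)
open import Data.Unit using (⊤)
open import Function.Bundles using (_↣_)
open import Relation.Nullary using (¬_)
open import Relation.Binary.PropositionalEquality using (_≡_; _≢_)

-- Alphabets.  F = {ini, fin} ∪ F̃ ; F and P disjoint (via a sum type).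

record Alphabet : Set₁ where
  field
    Fop           : Set
    Pred          : Set
    Fop-countable  : Fop ↣ ℕ
    Pred-countable : Pred ↣ ℕ

module _ (Σ' : Alphabet) where
  open Alphabet Σ'

  data Fun : Set where
    ini : Fun
    fin : Fun
    op  : Fop → Fun

  VLabel : Set
  VLabel = Fun ⊎ Pred

-- V = Fin nV (nonempty since r : Fin nV); E decidable subset of V × V;
-- vertex labelling lv and edge labelling le are partial (Maybe);
-- le is only consulted on pairs that are edges.

record LGraph (Σ' : Alphabet) : Set where
  field
    nV : ℕ
    E  : Fin nV → Fin nV → Bool
    lv : Fin nV → Maybe (VLabel Σ')
    le : Fin nV → Fin nV → Maybe Bool
    r  : Fin nV

module _ {Σ' : Alphabet} (G : LGraph Σ') where
  open Alphabet Σ'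
  open LGraph G

  Edge : Fin nV → Fin nV → Set
  Edge v w = E v w ≡ true

  outdeg : Fin nV → ℕ
  outdeg v = length (filterᵇ (λ w → E v w) (allFin nV))

  indeg : Fin nV → ℕ
  indeg v = length (filterᵇ (λ u → E u v) (allFin nV))

  FLabeled : Fin nV → Set
  FLabeled v = ∃ λ (f : Fun Σ') → lv v ≡ just (inj₁ f)

  OutUnlabeled : Fin nV → Set
  OutUnlabeled v = ∀ w → Edge v w → le v w ≡ nothing

  IsCycle : Fin nV → List (Fin nV) → Set
  IsCycle x vs = Unique (x ∷ vs) × Linked Edge ((x ∷ vs) ++ [ x ])

  record IsAlgorithmGraph : Set where
    field
      ini-iff-root₁ : ∀ v → lv v ≡ just (inj₁ ini) → v ≡ r
      ini-iff-root₂ : ∀ v → v ≡ r → lv v ≡ just (inj₁ ini)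
      ini-cond : ∀ v → lv v ≡ just (inj₁ ini) →
                 indeg v ≡ 0 × outdeg v ≡ 1 × OutUnlabeled v
      fin-cond : ∀ v → lv v ≡ just (inj₁ fin) →
                 indeg v > 0 × outdeg v ≡ 0
      op-cond  : ∀ v f → lv v ≡ just (inj₁ (op f)) →
                 indeg v > 0 × outdeg v ≡ 1 × OutUnlabeled v
      pred-cond : ∀ v p → lv v ≡ just (inj₂ p) →
                 indeg v > 0 × outdeg v ≡ 2
                 × (∀ w → Edge v w → ∃ λ b → le v w ≡ just b)
                 × (∀ w w' → Edge v w → Edge v w' → w ≢ w' → le v w ≢ le v w')
      cycle-cond : ∀ x vs → IsCycle x vs → Any FLabeled (x ∷ vs)

record Interpretation (Σ' : Alphabet) : Set₁ where
  open Alphabet Σ'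
  field
    D    : Set
    Din  : Set
    Dout : Set
    Iini  : Din → D
    Ifin  : D → Dout
    Iop   : Fop → D → D
    Ipred : Pred → D → Bool
    -- no proper subset of D contains Iini(Din) and is closed under all Iop f
    minimal : (S : D → Set) → (∀ x → S (Iini x)) →
              (∀ f d → S d → S (Iop f d)) → ∀ d → S d

record ProtoAlgorithm : Set₁ where
  field
    alph    : Alphabet
    G       : LGraph alph
    G-isAlg : IsAlgorithmGraph G
    𝓘       : Interpretation alph
  open LGraph G public
  open Interpretation 𝓘 public

module _ (A : ProtoAlgorithm) where
  open ProtoAlgorithm A

  data State : Set where
    inS  : Din → State
    midS : Fin nV → D → State
    outS : Dout → State

  -- astep, as the graph of the (partial) algorithmic step function
  data Step : State → State → Set where
    step-ini  : ∀ {d v} → Edge G r v → Step (inS d) (midS v (Iini d))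
    step-op   : ∀ {v w f d} → lv v ≡ just (inj₁ (op f)) → Edge G v w →
                Step (midS v d) (midS w (Iop f d))
    step-pred : ∀ {v w p d} → lv v ≡ just (inj₂ p) → Edge G v w →
                le v w ≡ just (Ipred p d) → Step (midS v d) (midS w d)
    step-fin  : ∀ {v d} → lv v ≡ just (inj₁ fin) →
                Step (midS v d) (outS (Ifin d))
    step-out  : ∀ {o} → Step (outS o) (outS o)

  data StepN : ℕ → State → State → Set where
    stepN-zero : ∀ {x} → StepN zero x x
    stepN-suc  : ∀ {n x y z} → Step x y → StepN n y z → StepN (suc n) x z

  -- astep^* as the least-defined partial function (inductive graph)
  data StepStar : State → Dout → Set where
    star-mid : ∀ {x v d o} → Step x (midS v d) → StepStar (midS v d) o →
               StepStar x o
    star-out : ∀ {x o} → Step x (outS o) → StepStar x o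

  Computes : Din → Dout → Set
  Computes d o = StepStar (inS d) o

  Defined : Din → Set
  Defined d = ∃ λ o → Computes d o

  Nas : Din → ℕ → Set
  Nas d n = Σ Dout λ o → Computes d o × StepN n (inS d) (outS o)
            × (∀ m → StepN m (inS d) (outS o) → n ≤ m)

module _ (A A' : ProtoAlgorithm) where
  private
    module A  = ProtoAlgorithm A
    module A' = ProtoAlgorithm A'

  SameKind : State A → State A' → Set
  SameKind (inS _)    (inS _)    = ⊤
  SameKind (midS _ _) (midS _ _) = ⊤
  SameKind (outS _)   (outS _)   = ⊤
  SameKind _          _          = ⊥

  record AlgSimulation : Set₁ where
    field
      R : State A → State A' → Set
      R-kind : ∀ x x' → R x x' → SameKind x x'
      R-in  : ∀ (d : A.Din) → Σ A'.Din λ d' → R (inS d) (inS d')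
                × (∀ d'' → R (inS d) (inS d'') → d'' ≡ d')
      R-out : ∀ (d' : A'.Dout) → Σ A.Dout λ d → R (outS d) (outS d')
                × (∀ d'' → R (outS d'') (outS d') → d'' ≡ d)
      R-step : ∀ x x' → R x x' →
               Σ (State A) λ y → Σ (State A') λ y' →
                 Step A x y × Step A' x' y' × R y y'

  _⊑ₐ_ : Set₁
  _⊑ₐ_ = AlgSimulation

-- A proto-algorithm is deterministic: ini and F̃-vertices have a single
-- successor, and the two edges leaving a P-vertex carry different labels.
-- Hence the step condition of a simulation R, which only asks for SOME pair
-- of related successors, actually relates astep x to astep x'.  By induction
-- R relates astepⁿ x to astepⁿ x' for every n, and since R relates outputs
-- only to outputs this works in both directions: A halts in exactly n steps
-- iff A' does from the related input, with outputs related by R.  h_in and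
-- h_out are the functions given by the two uniqueness clauses of R.

module Submission where

open import Defs
open import Data.Nat using (ℕ; zero; suc; _≤_)
open import Data.Product using (Σ; _×_; _,_; proj₁; proj₂; ∃)
open import Data.Bool using (T)
open import Data.Bool.Properties using (T?)
open import Data.Unit using (tt)
open import Data.Empty using (⊥-elim)
open import Data.Fin using (Fin; _≟_)
open import Data.List using (List; []; _∷_; filterᵇ; allFin; length)
open import Data.List.Relation.Unary.Any using (here; there)
open import Data.List.Membership.Propositional using (_∈_)
open import Data.List.Membership.Propositional.Properties using (∈-filter⁺; ∈-allFin)
open import Relation.Nullary using (yes; no)
open import Relation.Binary.PropositionalEquality
  using (_≡_; refl; sym; trans; subst)

length≡1⇒∈-unique : ∀ {X : Set} (xs : List X) {x y : X} →
                    length xs ≡ 1 → x ∈ xs → y ∈ xs → x ≡ y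
length≡1⇒∈-unique (_ ∷ []) refl (here refl) (here refl) = refl

module Deterministic (A : ProtoAlgorithm) where
  open ProtoAlgorithm A
  open IsAlgorithmGraph G-isAlg

  edge⇒∈successors : ∀ {v} w → Edge G v w → w ∈ filterᵇ (E v) (allFin nV)
  edge⇒∈successors {v} w e =
    ∈-filter⁺ (λ u → T? (E v u)) (∈-allFin w) (subst T (sym e) tt)

  outdeg≡1⇒edge-unique : ∀ {v w w'} → outdeg G v ≡ 1 →
                         Edge G v w → Edge G v w' → w ≡ w'
  outdeg≡1⇒edge-unique {w = w} {w'} deg e e' =
    length≡1⇒∈-unique _ deg (edge⇒∈successors w e) (edge⇒∈successors w' e')

  same-label : ∀ {v a b} → lv v ≡ a → lv v ≡ b → a ≡ b
  same-label l l' = trans (sym l) l'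

  Step-deterministic : ∀ {x y y'} → Step A x y → Step A x y' → y ≡ y'
  Step-deterministic (step-ini e) (step-ini e')
    with outdeg≡1⇒edge-unique (proj₁ (proj₂ (ini-cond r (ini-iff-root₂ r refl)))) e e'
  ... | refl = refl
  Step-deterministic (step-op {v} l e) (step-op l' e') with same-label l l'
  ... | refl with outdeg≡1⇒edge-unique (proj₁ (proj₂ (op-cond v _ l))) e e'
  ... | refl = refl
  Step-deterministic (step-pred {v} {w} l e b) (step-pred {w = w'} l' e' b')
    with same-label l l'
  ... | refl with w ≟ w'
  ... | yes refl = refl
  ... | no w≢w' =
    ⊥-elim (proj₂ (proj₂ (proj₂ (pred-cond v _ l))) w w' e e' w≢w' (trans b (sym b')))
  Step-deterministic (step-fin l) (step-fin l') = refl
  Step-deterministic step-out step-out = refl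
  Step-deterministic (step-op l _) (step-pred l' _ _) with same-label l l'
  ... | ()
  Step-deterministic (step-op l _) (step-fin l') with same-label l l'
  ... | ()
  Step-deterministic (step-pred l _ _) (step-op l' _) with same-label l l'
  ... | ()
  Step-deterministic (step-pred l _ _) (step-fin l') with same-label l l'
  ... | ()
  Step-deterministic (step-fin l) (step-op l' _) with same-label l l'
  ... | ()
  Step-deterministic (step-fin l) (step-pred l' _ _) with same-label l l'
  ... | ()

  StepN-from-outS : ∀ {n o z} → StepN A n (outS o) z → z ≡ outS o
  StepN-from-outS stepN-zero = refl
  StepN-from-outS (stepN-suc step-out s) = StepN-from-outS s

  StepN-output-unique : ∀ {m n x o o'} →
    StepN A m x (outS o) → StepN A n x (outS o') → o ≡ o'
  StepN-output-unique stepN-zero s' with StepN-from-outS s'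
  ... | refl = refl
  StepN-output-unique s@(stepN-suc _ _) stepN-zero with StepN-from-outS s
  ... | refl = refl
  StepN-output-unique (stepN-suc t s) (stepN-suc t' s')
    with Step-deterministic t t'
  ... | refl = StepN-output-unique s s'

  StepN⇒StepStar : ∀ {n x o} → StepN A n x (outS o) → StepStar A x o
  StepN⇒StepStar stepN-zero = star-out step-out
  StepN⇒StepStar (stepN-suc {y = midS _ _} t s) = star-mid t (StepN⇒StepStar s)
  StepN⇒StepStar (stepN-suc {y = outS _} t s) with StepN-from-outS s
  ... | refl = star-out t

  StepStar⇒StepN : ∀ {x o} → StepStar A x o → ∃ λ n → StepN A n x (outS o)
  StepStar⇒StepN (star-mid t st) with StepStar⇒StepN st
  ... | n , s = suc n , stepN-suc t s
  StepStar⇒StepN (star-out t) = 1 , stepN-suc t stepN-zero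

module _ {A A' : ProtoAlgorithm} where

  SameKind-outSˡ : ∀ {o} (z' : State A') → SameKind A A' (outS o) z' →
                   ∃ λ o' → z' ≡ outS o'
  SameKind-outSˡ (outS o') _ = o' , refl

  SameKind-outSʳ : ∀ {o'} (z : State A) → SameKind A A' z (outS o') →
                   ∃ λ o → z ≡ outS o
  SameKind-outSʳ (outS o) _ = o , refl

module Simulation {A A' : ProtoAlgorithm} (S : _⊑ₐ_ A A') where
  open AlgSimulation S
  private
    module A  = Deterministic A
    module A' = Deterministic A'

  R-StepN-forward : ∀ {n x x' z} → R x x' → StepN A n x z →
                    ∃ λ z' → StepN A' n x' z' × R z z'
  R-StepN-forward {x' = x'} rel stepN-zero = x' , stepN-zero , rel
  R-StepN-forward {x = x} {x'} rel (stepN-suc t s) with R-step x x' rel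
  ... | _ , _ , u , u' , rel₁ with A.Step-deterministic u t
  ... | refl with R-StepN-forward rel₁ s
  ... | z' , s' , rel₂ = z' , stepN-suc u' s' , rel₂

  R-StepN-backward : ∀ {n x x' z'} → R x x' → StepN A' n x' z' →
                     ∃ λ z → StepN A n x z × R z z'
  R-StepN-backward {x = x} rel stepN-zero = x , stepN-zero , rel
  R-StepN-backward {x = x} {x'} rel (stepN-suc t' s') with R-step x x' rel
  ... | _ , _ , u , u' , rel₁ with A'.Step-deterministic u' t'
  ... | refl with R-StepN-backward rel₁ s'
  ... | z , s , rel₂ = z , stepN-suc u s , rel₂

  hin : ProtoAlgorithm.Din A → ProtoAlgorithm.Din A'
  hin d = proj₁ (R-in d)

  hout : ProtoAlgorithm.Dout A' → ProtoAlgorithm.Dout A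
  hout o' = proj₁ (R-out o')

  R-hin : ∀ d → R (inS d) (inS (hin d))
  R-hin d = proj₁ (proj₂ (R-in d))

  R-outS⇒hout : ∀ {o o'} → R (outS o) (outS o') → o ≡ hout o'
  R-outS⇒hout {o} {o'} rel = proj₂ (proj₂ (R-out o')) o rel

  halts-forward : ∀ {n d o} → StepN A n (inS d) (outS o) →
                  ∃ λ o' → StepN A' n (inS (hin d)) (outS o') × o ≡ hout o'
  halts-forward s with R-StepN-forward (R-hin _) s
  ... | z' , s' , rel with SameKind-outSˡ z' (R-kind _ z' rel)
  ... | o' , refl = o' , s' , R-outS⇒hout rel

  halts-backward : ∀ {n d o'} → StepN A' n (inS (hin d)) (outS o') →
                   ∃ λ o → StepN A n (inS d) (outS o) × o ≡ hout o'
  halts-backward s' with R-StepN-backward (R-hin _) s'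
  ... | z , s , rel with SameKind-outSʳ z (R-kind z _ rel)
  ... | o , refl = o , s , R-outS⇒hout rel

  preserves-Defined : ∀ d → Defined A d → Defined A' (hin d)
  preserves-Defined d (_ , c) with halts-forward (proj₂ (A.StepStar⇒StepN c))
  ... | o' , s' , _ = o' , A'.StepN⇒StepStar s'

  hout-reflects-Computes : ∀ d o → Computes A d o →
                           ∀ o' → Computes A' (hin d) o' → hout o' ≡ o
  hout-reflects-Computes d o c o' c'
    with halts-backward (proj₂ (A'.StepStar⇒StepN c'))
  ... | _ , s , o₁≡hout =
    trans (sym o₁≡hout) (A.StepN-output-unique s (proj₂ (A.StepStar⇒StepN c)))

  preserves-Nas : ∀ d n → Nas A d n → Nas A' (hin d) n
  preserves-Nas d n (o , _ , s , minimal) with halts-forward s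
  ... | o' , s' , _ = o' , A'.StepN⇒StepStar s' , s' , minimal'
    where
    minimal' : ∀ m → StepN A' m (inS (hin d)) (outS o') → n ≤ m
    minimal' m t' with halts-backward t'
    ... | _ , t , _ with A.StepN-output-unique t s
    ... | refl = minimal m t

theorem2 : (A A' : ProtoAlgorithm) → _⊑ₐ_ A A' →
    Σ (ProtoAlgorithm.Din A → ProtoAlgorithm.Din A') λ hin →
    Σ (ProtoAlgorithm.Dout A' → ProtoAlgorithm.Dout A) λ hout →
    (∀ d → Defined A d → Defined A' (hin d))
    × (∀ d d' → Computes A d d' → ∀ e' → Computes A' (hin d) e' → hout e' ≡ d')
    × (∀ d → Defined A d → ∀ (n : ℕ) → Nas A d n → Nas A' (hin d) n)
theorem2 A A' S =
  hin , hout , preserves-Defined , hout-reflects-Computes , λ d _ → preserves-Nas d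
  where open Simulation S
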